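{- Let $p$ be a prime number and let $G$ be a $p$-group of order $>1$ with the following property: every subgroup $G'\subset G$ is equal to the intersection of the family of all subgroups of index $p$ in $G$ that contain $G'$. Then $G$ is commutative of exponent $p$. -}

module Defs where

open import Level using (0ℓ)
open import Data.Nat using (ℕ; zero; suc; _*_; _^_; _<_)
open import Data.Fin using (Fin)
open import Data.Fin.Subset using (Subset; _∈_; _⊆_; ∣_∣)
open import Data.Product using (_×_; ∃)
open import Relation.Binary.PropositionalEquality using (_≡_)
open import Algebra.Core using (Op₁; Op₂)
open import Algebra.Structures using (IsGroup)
open import Function.Bundles using (_⇔_)

-- A finite group of order n, presented (up to isomorphism) as a group
-- structure on the carrier Fin n with propositional equality.
record FiniteGroup (n : ℕ) : Set where
  field
    _∙_     : Op₂ (Fin n)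
    ε       : Fin n
    _⁻¹     : Op₁ (Fin n)
    isGroup : IsGroup _≡_ _∙_ ε _⁻¹

  pow : Fin n → ℕ → Fin n
  pow x zero    = ε
  pow x (suc k) = x ∙ pow x k

  record IsSubgroup (H : Subset n) : Set where
    field
      ε-closed : ε ∈ H
      ∙-closed : ∀ {x y} → x ∈ H → y ∈ H → (x ∙ y) ∈ H
      ⁻¹-closed : ∀ {x} → x ∈ H → (x ⁻¹) ∈ H

  HasIndex : Subset n → ℕ → Set
  HasIndex M p = ∣ M ∣ * p ≡ n

  IntersectionProperty : ℕ → Set
  IntersectionProperty p =
    ∀ (H : Subset n) → IsSubgroup H → ∀ x →
      (x ∈ H) ⇔ (∀ (M : Subset n) → IsSubgroup M → HasIndex M p → H ⊆ M → x ∈ M)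

  IsCommutative : Set
  IsCommutative = ∀ x y → (x ∙ y) ≡ (y ∙ x)

  -- exponent divides p (for a nontrivial group with p prime this is exponent = p)
  ExponentDivides : ℕ → Set
  ExponentDivides p = ∀ x → pow x p ≡ ε

IsPGroupOrder : ℕ → ℕ → Set
IsPGroupOrder p n = ∃ λ k → n ≡ p ^ k

-- The trivial subgroup is the intersection of the subgroups of index p, so it
-- suffices that every subgroup M of index p is normal and contains all p-th
-- powers and all commutators.
--
-- Counting the pairs (i, y) with cᵢ⁻¹ y ∈ M shows that at most p elements lie in
-- pairwise distinct left cosets of M; the same double count over the orbits of
-- ⟨g⟩ is Lagrange's theorem for cyclic subgroups, so g ^ |G| = ε.  For g, c ∈ G
-- the exponents i with gⁱ c M = c M are the multiples of a least r > 0; the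
-- cosets gⁱ c M (i < r) are distinct and r divides |G| = p ^ k, so r = 1 or r = p.
-- For c = ε and g ∉ M this gives g ^ p ∈ M, and 1, g, …, g ^ (p - 1) represent
-- all cosets.  For g ∈ M and c ∉ M the coset M is a further one, so r < p, hence
-- r = 1: M is normal.  Finally every y is gⁱ m with m ∈ M, and by normality m
-- commutes with g modulo M.

module Submission where

open import Defs
open import Level using (0ℓ)
open import Algebra.Bundles using (Group)
open import Algebra.Structures using (IsGroup)
import Algebra.Properties.Group as GroupProperties
open import Data.Nat using (ℕ; zero; suc; _+_; _*_; _∸_; _^_; _≤_; _<_; _≤?_; _<?_)
open import Data.Nat using (z≤n; NonZero; >-nonZero; ≢-nonZero)
open import Data.Nat.Properties hiding (0≢1+n; suc-injective; _≟_)
open import Algebra.Properties.CommutativeMonoid.Sum +-0-commutativeMonoid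
  using (sum; sum-cong-≗; sum-replicate-zero; ∑-comm; ∑-permute)
open import Data.Nat.DivMod using (_%_; _/_; m≡m%n+[m/n]*n; m%n<n)
open import Data.Nat.Divisibility using (_∣_; divides; ∣1⇒≡1; m%n≡0⇒n∣m)
import Data.Nat.Coprimality as Coprime
open import Data.Nat.Induction using (<-rec)
open import Data.Nat.Primality using (Prime)
open import Data.Fin using (Fin; zero; suc; toℕ; fromℕ<; _≟_)
open import Data.Fin.Properties
  using (toℕ<n; toℕ-injective; toℕ-fromℕ<; pigeonhole; all?; any?; 0≢1+n; suc-injective)
open import Data.Fin.Permutation using (permutation)
open import Data.Fin.Subset using (Subset; _∈_; _∉_; ∣_∣; inside; outside; ⁅_⁆)
open import Data.Fin.Subset.Properties using (_∈?_; x∈⁅x⁆; x∈⁅y⁆⇒x≡y)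
open import Data.List using (allFin)
open import Data.List.Extrema.Nat using (argmin; f[argmin]≤f[xs])
import Data.List.Relation.Unary.All as All
open import Data.List.Membership.Propositional.Properties using (∈-allFin)
open import Data.Vec using ([]; _∷_)
open import Data.Vec.Base using (here; there)
import Data.Vec.Functional as Vector
open import Data.Product using (_×_; _,_; ∃)
open import Data.Sum using (_⊎_; inj₁; inj₂; [_,_]′)
open import Function using (_∘_)
open import Function.Bundles using (Equivalence)
open import Relation.Binary using (Rel; Symmetric)
open import Relation.Binary.PropositionalEquality
open import Relation.Nullary using (Dec; yes; no; ¬_; contradiction)
open import Relation.Nullary.Decidable using (_×-dec_)
open import Relation.Unary using (Pred; Decidable)

private
  variable
    A B : Set

𝟙 : Dec A → ℕ
𝟙 (yes _) = 1
𝟙 (no _)  = 0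

𝟙-yes : (a? : Dec A) → A → 𝟙 a? ≡ 1
𝟙-yes (yes _) _ = refl
𝟙-yes (no ¬a) a = contradiction a ¬a

𝟙-no : (a? : Dec A) → ¬ A → 𝟙 a? ≡ 0
𝟙-no (yes a) ¬a = contradiction a ¬a
𝟙-no (no _)  _  = refl

𝟙-cong : (A → B) → (B → A) → (a? : Dec A) (b? : Dec B) → 𝟙 a? ≡ 𝟙 b?
𝟙-cong f g (yes a) b? = sym (𝟙-yes b? (f a))
𝟙-cong f g (no ¬a) b? = sym (𝟙-no b? (¬a ∘ g))

∑-const : ∀ m a → sum {m} (λ _ → a) ≡ m * a
∑-const zero    a = refl
∑-const (suc m) a = cong (a +_) (∑-const m a)

∑-1 : ∀ m → sum {m} (λ _ → 1) ≡ m
∑-1 m = trans (∑-const m 1) (*-identityʳ m)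

∑-mono-≤ : ∀ {m} {f g : Fin m → ℕ} → (∀ i → f i ≤ g i) → sum f ≤ sum g
∑-mono-≤ {zero}  f≤g = z≤n
∑-mono-≤ {suc m} f≤g = +-mono-≤ (f≤g zero) (∑-mono-≤ (f≤g ∘ suc))

term≤∑ : ∀ {m} (f : Fin m → ℕ) i → f i ≤ sum f
term≤∑ f zero    = m≤m+n (f zero) _
term≤∑ f (suc i) = ≤-trans (term≤∑ (f ∘ suc) i) (m≤n+m _ (f zero))

∑𝟙-unique≤1 : ∀ {m} {P : Pred (Fin m) 0ℓ} (P? : Decidable P) →
  (∀ {i j} → P i → P j → i ≡ j) → sum (𝟙 ∘ P?) ≤ 1
∑𝟙-unique≤1 {zero}      P? unique = z≤n
∑𝟙-unique≤1 {suc m} {P} P? unique with P? zero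
... | yes P0 = ≤-reflexive (cong suc (trans (sum-cong-≗ rest≡0) (sum-replicate-zero m)))
  where
  rest≡0 : ∀ i → 𝟙 (P? (suc i)) ≡ 0
  rest≡0 i = 𝟙-no (P? (suc i)) (0≢1+n ∘ unique P0)
... | no _   = ∑𝟙-unique≤1 (P? ∘ suc) (λ Pi Pj → suc-injective (unique Pi Pj))

∑𝟙-unique≡1 : ∀ {m} {P : Pred (Fin m) 0ℓ} (P? : Decidable P) →
  (∀ {i j} → P i → P j → i ≡ j) → ∃ P → sum (𝟙 ∘ P?) ≡ 1
∑𝟙-unique≡1 P? unique (j , Pj) = ≤-antisym (∑𝟙-unique≤1 P? unique)
  (subst (_≤ sum (𝟙 ∘ P?)) (𝟙-yes (P? j) Pj) (term≤∑ (𝟙 ∘ P?) j))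

∑𝟙∈-∷ : ∀ {m} b (M : Subset m) → sum (λ y → 𝟙 (y ∈? M)) ≡ sum (λ y → 𝟙 (suc y ∈? (b ∷ M)))
∑𝟙∈-∷ b M = sum-cong-≗ λ y → 𝟙-cong there (λ { (there y∈M) → y∈M }) (y ∈? M) (suc y ∈? (b ∷ M))

∣p∣≡∑𝟙∈ : ∀ {m} (M : Subset m) → ∣ M ∣ ≡ sum (λ y → 𝟙 (y ∈? M))
∣p∣≡∑𝟙∈ []            = refl
∣p∣≡∑𝟙∈ (inside ∷ M)  =
  cong₂ _+_ (sym (𝟙-yes (zero ∈? (inside ∷ M)) here)) (trans (∣p∣≡∑𝟙∈ M) (∑𝟙∈-∷ inside M))
∣p∣≡∑𝟙∈ (outside ∷ M) =
  cong₂ _+_ (sym (𝟙-no (zero ∈? (outside ∷ M)) λ ())) (trans (∣p∣≡∑𝟙∈ M) (∑𝟙∈-∷ outside M))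

argminFin : ∀ {m} (f : Fin (suc m) → ℕ) → ∃ λ j → ∀ i → f j ≤ f i
argminFin {m} f = argmin f zero (allFin _) ,
  λ i → All.lookup (f[argmin]≤f[xs] {f = f} zero (allFin (suc m))) (∈-allFin i)

record LeastPositive (Q : Pred ℕ 0ℓ) (r : ℕ) : Set where
  field
    positive : 0 < r
    holds    : Q r
    minimal  : ∀ {s} → 0 < s → s < r → ¬ Q s

module _ {Q : Pred ℕ 0ℓ} where

  leastPositive : Decidable Q → ∀ {m} → 0 < m → Q m → ∃ (LeastPositive Q)
  leastPositive Q? {m} = <-rec (λ m → 0 < m → Q m → ∃ (LeastPositive Q)) search m
    where
    search : ∀ m → (∀ {s} → s < m → 0 < s → Q s → ∃ (LeastPositive Q)) →
             0 < m → Q m → ∃ (LeastPositive Q)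
    search m below m>0 Qm with anyUpTo? (λ s → 0 <? s ×-dec Q? s) m
    ... | yes (s , s<m , s>0 , Qs) = below s<m s>0 Qs
    ... | no none = m , record
      { positive = m>0
      ; holds    = Qm
      ; minimal  = λ s>0 s<m Qs → none (_ , s<m , s>0 , Qs)
      }

  leastPositive-separates : ∀ {r} → LeastPositive Q r → {R : Rel (Fin r) 0ℓ} → Symmetric R →
    (∀ {i j} → toℕ i ≤ toℕ j → R i j → Q (toℕ j ∸ toℕ i)) → ∀ {i j} → R i j → i ≡ j
  leastPositive-separates least {R} R-sym R⇒Q {i} {j} Rij =
    [ (λ i≤j → ordered i≤j Rij) , (λ j≤i → sym (ordered j≤i (R-sym Rij))) ]′ (≤-total (toℕ i) (toℕ j))
    where
    open LeastPositive least
    ordered : ∀ {i j} → toℕ i ≤ toℕ j → R i j → i ≡ j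
    ordered {i} {j} i≤j Rij with m≤n⇒m<n∨m≡n i≤j
    ... | inj₁ i<j = contradiction (R⇒Q i≤j Rij)
            (minimal (m<n⇒0<n∸m i<j) (≤-<-trans (m∸n≤m (toℕ j) (toℕ i)) (toℕ<n j)))
    ... | inj₂ i≡j = toℕ-injective i≡j

  module _ (Q-0 : Q 0) (Q-+ : ∀ {a b} → Q a → Q b → Q (a + b))
           (Q-∸ : ∀ {a b} → Q a → Q (a + b) → Q b) where

    Q-multiple : ∀ {r} → Q r → ∀ q → Q (q * r)
    Q-multiple Qr zero    = Q-0
    Q-multiple Qr (suc q) = Q-+ Qr (Q-multiple Qr q)

    leastPositive-∣ : ∀ {r m} → LeastPositive Q r → Q m → r ∣ m
    leastPositive-∣ {r} {m} least Qm =
      m%n≡0⇒n∣m m r (n≤0⇒n≡0 (≮⇒≥ λ rem>0 → minimal rem>0 (m%n<n m r) Q-rem))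
      where
      open LeastPositive least
      instance
        r≢0 : NonZero r
        r≢0 = >-nonZero positive
      Q-rem : Q (m % r)
      Q-rem = Q-∸ (Q-multiple holds (m / r))
                  (subst Q (trans (m≡m%n+[m/n]*n m r) (+-comm (m % r) (m / r * r))) Qm)

∣p^k∧<p⇒≡1 : ∀ {p} → Prime p → ∀ k {r} → r ∣ p ^ k → 0 < r → r < p → r ≡ 1
∣p^k∧<p⇒≡1 p-prime zero    r∣1   _   _   = ∣1⇒≡1 r∣1
∣p^k∧<p⇒≡1 p-prime (suc k) r∣p^k r>0 r<p = ∣p^k∧<p⇒≡1 p-prime k
  (Coprime.coprime-divisor (Coprime.sym (Coprime.prime⇒coprime p-prime {{>-nonZero r>0}} r<p)) r∣p^k) r>0 r<p

module FiniteGroupProperties {n : ℕ} (G : FiniteGroup n) where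
  open FiniteGroup G
  open IsGroup isGroup using (assoc; identityˡ; identityʳ; _\\_)

  group : Group 0ℓ 0ℓ
  group = record { isGroup = isGroup }

  open GroupProperties group public
    using ( ∙-cancelˡ; ∙-cancelʳ; \\-leftDividesˡ; \\-leftDividesʳ
          ; ⁻¹-involutive; ⁻¹-anti-homo-∙; ε⁻¹≈ε; inverseʳ-unique)

  0<n : 0 < n
  0<n = ≤-<-trans z≤n (toℕ<n ε)

  \\≡ε⇒≡ : ∀ {x y} → x \\ y ≡ ε → x ≡ y
  \\≡ε⇒≡ {x} {y} x\\y≡ε = trans (sym (⁻¹-involutive x)) (sym (inverseʳ-unique (x ⁻¹) y x\\y≡ε))

  \\-translate : ∀ z x y → (z ∙ x) \\ (z ∙ y) ≡ x \\ y
  \\-translate z x y = begin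
    ((z ∙ x) ⁻¹) ∙ (z ∙ y)        ≡⟨ cong (_∙ (z ∙ y)) (⁻¹-anti-homo-∙ z x) ⟩
    ((x ⁻¹) ∙ (z ⁻¹)) ∙ (z ∙ y)   ≡⟨ assoc (x ⁻¹) (z ⁻¹) (z ∙ y) ⟩
    (x ⁻¹) ∙ ((z ⁻¹) ∙ (z ∙ y))   ≡⟨ cong ((x ⁻¹) ∙_) (\\-leftDividesʳ z y) ⟩
    (x ⁻¹) ∙ y                    ∎
    where open ≡-Reasoning

  ⁅ε⁆-isSubgroup : IsSubgroup ⁅ ε ⁆
  ⁅ε⁆-isSubgroup = record
    { ε-closed  = x∈⁅x⁆ ε
    ; ∙-closed  = λ x∈ y∈ → subst (_∈ ⁅ ε ⁆)
        (sym (trans (cong₂ _∙_ (x∈⁅y⁆⇒x≡y ε x∈) (x∈⁅y⁆⇒x≡y ε y∈)) (identityˡ ε))) (x∈⁅x⁆ ε)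
    ; ⁻¹-closed = λ x∈ → subst (_∈ ⁅ ε ⁆) (sym (trans (cong _⁻¹ (x∈⁅y⁆⇒x≡y ε x∈)) ε⁻¹≈ε)) (x∈⁅x⁆ ε)
    }

  pow-+ : ∀ x a b → pow x (a + b) ≡ pow x a ∙ pow x b
  pow-+ x zero    b = sym (identityˡ (pow x b))
  pow-+ x (suc a) b = trans (cong (x ∙_) (pow-+ x a b)) (sym (assoc x (pow x a) (pow x b)))

  pow-+-∙ : ∀ x a b c → pow x (a + b) ∙ c ≡ pow x a ∙ (pow x b ∙ c)
  pow-+-∙ x a b c = trans (cong (_∙ c) (pow-+ x a b)) (assoc (pow x a) (pow x b) c)

  pow-comm : ∀ x i → x ∙ pow x i ≡ pow x i ∙ x
  pow-comm x zero    = trans (identityʳ x) (sym (identityˡ x))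
  pow-comm x (suc i) = trans (cong (x ∙_) (pow-comm x i)) (sym (assoc x (pow x i) x))

  pow-multiple : ∀ x {e} → pow x e ≡ ε → ∀ q → pow x (q * e) ≡ ε
  pow-multiple x xᵉ≡ε zero    = refl
  pow-multiple x {e} xᵉ≡ε (suc q) = begin
    pow x (e + q * e)          ≡⟨ pow-+ x e (q * e) ⟩
    pow x e ∙ pow x (q * e)    ≡⟨ cong₂ _∙_ xᵉ≡ε (pow-multiple x xᵉ≡ε q) ⟩
    ε ∙ ε                      ≡⟨ identityˡ ε ⟩
    ε                          ∎
    where open ≡-Reasoning

  pow-∸ : ∀ x {i j} → i ≤ j → pow x i ≡ pow x j → pow x (j ∸ i) ≡ ε
  pow-∸ x {i} {j} i≤j xⁱ≡xʲ = ∙-cancelˡ (pow x i) (pow x (j ∸ i)) ε (begin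
    pow x i ∙ pow x (j ∸ i)  ≡⟨ pow-+ x i (j ∸ i) ⟨
    pow x (i + (j ∸ i))      ≡⟨ cong (pow x) (m+[n∸m]≡n i≤j) ⟩
    pow x j                  ≡⟨ xⁱ≡xʲ ⟨
    pow x i                  ≡⟨ identityʳ (pow x i) ⟨
    pow x i ∙ ε              ∎)
    where open ≡-Reasoning

  ∑-translate : ∀ a (f : Fin n → ℕ) → sum (λ y → f (a ∙ y)) ≡ sum f
  ∑-translate a f =
    sym (∑-permute f (permutation (a ∙_) (a \\_) (\\-leftDividesˡ a) (\\-leftDividesʳ a)))

  ∑∑𝟙-translates : ∀ {r} (c : Fin r → Fin n) {P : Pred (Fin n) 0ℓ} (P? : Decidable P) →
    sum (λ y → sum (λ i → 𝟙 (P? (c i ∙ y)))) ≡ r * sum (𝟙 ∘ P?)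
  ∑∑𝟙-translates {r} c P? = begin
    sum (λ y → sum (λ i → 𝟙 (P? (c i ∙ y))))  ≡⟨ ∑-comm (λ y i → 𝟙 (P? (c i ∙ y))) ⟩
    sum (λ i → sum (λ y → 𝟙 (P? (c i ∙ y))))  ≡⟨ sum-cong-≗ (λ i → ∑-translate (c i) (𝟙 ∘ P?)) ⟩
    sum {r} (λ _ → sum (𝟙 ∘ P?))              ≡⟨ ∑-const r _ ⟩
    r * sum (𝟙 ∘ P?)                          ∎
    where open ≡-Reasoning

  module Lagrange {d} (a : Fin (suc d) → Fin n) (a-injective : ∀ {i j} → a i ≡ a j → i ≡ j)
                  (a-∙-closed : ∀ i j → ∃ λ t → a t ≡ a i ∙ a j)
                  (a-//-closed : ∀ i j → ∃ λ t → a t ∙ a i ≡ a j) where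

    -- canonical representatives of the orbits {a t ∙ y}: their least elements in Fin n
    IsOrbitMin : Pred (Fin n) 0ℓ
    IsOrbitMin v = ∀ t → toℕ v ≤ toℕ (a t ∙ v)

    isOrbitMin? : Decidable IsOrbitMin
    isOrbitMin? v = all? (λ t → toℕ v ≤? toℕ (a t ∙ v))

    orbitMin-exists : ∀ y → ∃ λ j → IsOrbitMin (a j ∙ y)
    orbitMin-exists y = from-min (argminFin (λ i → toℕ (a i ∙ y)))
      where
      from-min : (∃ λ j → ∀ i → toℕ (a j ∙ y) ≤ toℕ (a i ∙ y)) → ∃ λ j → IsOrbitMin (a j ∙ y)
      from-min (j , j-min) = j , λ t → let s , aₛ≡aₜaⱼ = a-∙-closed t j in
        subst (λ z → toℕ (a j ∙ y) ≤ toℕ z)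
              (trans (cong (_∙ y) aₛ≡aₜaⱼ) (assoc (a t) (a j) y)) (j-min s)

    orbitMin-unique : ∀ y {i j} → IsOrbitMin (a i ∙ y) → IsOrbitMin (a j ∙ y) → i ≡ j
    orbitMin-unique y {i} {j} i-min j-min =
      a-injective (∙-cancelʳ y (a i) (a j) (toℕ-injective (≤-antisym (below i-min) (below j-min))))
      where
      below : ∀ {i j} → IsOrbitMin (a i ∙ y) → toℕ (a i ∙ y) ≤ toℕ (a j ∙ y)
      below {i} {j} i-min = let t , aₜaᵢ≡aⱼ = a-//-closed i j in
        subst (λ z → toℕ (a i ∙ y) ≤ toℕ z)
              (trans (sym (assoc (a t) (a i) y)) (cong (_∙ y) aₜaᵢ≡aⱼ)) (i-min t)

    card≡size*orbits : n ≡ suc d * sum (𝟙 ∘ isOrbitMin?)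
    card≡size*orbits = begin
      n                                                  ≡⟨ ∑-1 n ⟨
      sum {n} (λ _ → 1)                                  ≡⟨ sum-cong-≗ one-representative ⟨
      sum (λ y → sum (λ j → 𝟙 (isOrbitMin? (a j ∙ y))))  ≡⟨ ∑∑𝟙-translates a isOrbitMin? ⟩
      suc d * sum (𝟙 ∘ isOrbitMin?)                      ∎
      where
      open ≡-Reasoning
      one-representative : ∀ y → sum (λ j → 𝟙 (isOrbitMin? (a j ∙ y))) ≡ 1
      one-representative y =
        ∑𝟙-unique≡1 (λ j → isOrbitMin? (a j ∙ y)) (orbitMin-unique y) (orbitMin-exists y)

    size∣card : suc d ∣ n
    size∣card = divides (sum (𝟙 ∘ isOrbitMin?))
                        (trans card≡size*orbits (*-comm (suc d) (sum (𝟙 ∘ isOrbitMin?))))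

  module _ (g : Fin n) {d} (order : LeastPositive (λ e → pow g e ≡ ε) (suc d)) where
    open LeastPositive order

    powers : Fin (suc d) → Fin n
    powers i = pow g (toℕ i)

    reduce : ℕ → Fin (suc d)
    reduce e = fromℕ< (m%n<n e (suc d))

    powers-reduce : ∀ e → powers (reduce e) ≡ pow g e
    powers-reduce e = begin
      pow g (toℕ (reduce e))             ≡⟨ cong (pow g) (toℕ-fromℕ< (m%n<n e (suc d))) ⟩
      pow g (e % suc d)                  ≡⟨ identityʳ (pow g (e % suc d)) ⟨
      pow g (e % suc d) ∙ ε              ≡⟨ cong (pow g (e % suc d) ∙_) (pow-multiple g holds q) ⟨
      pow g (e % suc d) ∙ pow g (q * suc d)  ≡⟨ pow-+ g (e % suc d) (q * suc d) ⟨
      pow g (e % suc d + q * suc d)      ≡⟨ cong (pow g) (m≡m%n+[m/n]*n e (suc d)) ⟨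
      pow g e                            ∎
      where
      open ≡-Reasoning
      q : ℕ
      q = e / suc d

    powers-injective : ∀ {i j} → powers i ≡ powers j → i ≡ j
    powers-injective = leastPositive-separates order sym (pow-∸ g)

    powers-∙-closed : ∀ i j → ∃ λ t → powers t ≡ powers i ∙ powers j
    powers-∙-closed i j =
      reduce (toℕ i + toℕ j) , trans (powers-reduce (toℕ i + toℕ j)) (pow-+ g (toℕ i) (toℕ j))

    powers-//-closed : ∀ i j → ∃ λ t → powers t ∙ powers i ≡ powers j
    powers-//-closed i j = reduce e , (begin
      powers (reduce e) ∙ powers i  ≡⟨ cong (_∙ powers i) (powers-reduce e) ⟩
      pow g e ∙ powers i            ≡⟨ pow-+ g e (toℕ i) ⟨
      pow g (e + toℕ i)             ≡⟨ cong (pow g) e+i≡j+d ⟩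
      pow g (toℕ j + suc d)         ≡⟨ pow-+ g (toℕ j) (suc d) ⟩
      powers j ∙ pow g (suc d)      ≡⟨ cong (powers j ∙_) holds ⟩
      powers j ∙ ε                  ≡⟨ identityʳ (powers j) ⟩
      powers j                      ∎)
      where
      open ≡-Reasoning
      e : ℕ
      e = toℕ j + (suc d ∸ toℕ i)
      e+i≡j+d : e + toℕ i ≡ toℕ j + suc d
      e+i≡j+d = trans (+-assoc (toℕ j) (suc d ∸ toℕ i) (toℕ i)) (cong (toℕ j +_) (m∸n+n≡m (<⇒≤ (toℕ<n i))))

    order∣card : suc d ∣ n
    order∣card = Lagrange.size∣card powers powers-injective powers-∙-closed powers-//-closed

  pow-card≡ε : ∀ g → pow g n ≡ ε
  pow-card≡ε g = from-repetition (pigeonhole (n<1+n n) (λ i → pow g (toℕ i)))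
    where
    from-order : ∃ (LeastPositive (λ e → pow g e ≡ ε)) → pow g n ≡ ε
    from-order (zero  , record { positive = () })
    from-order (suc d , order) = let divides q n≡q*order = order∣card g order in
      trans (cong (pow g) n≡q*order) (pow-multiple g (LeastPositive.holds order) q)

    from-repetition : (∃ λ (i : Fin (suc n)) → ∃ λ j → toℕ i < toℕ j × pow g (toℕ i) ≡ pow g (toℕ j)) →
                      pow g n ≡ ε
    from-repetition (i , j , i<j , gⁱ≡gʲ) =
      from-order (leastPositive (λ e → pow g e ≟ ε) (m<n⇒0<n∸m i<j) (pow-∸ g (<⇒≤ i<j) gⁱ≡gʲ))

module SubgroupProperties {n : ℕ} (G : FiniteGroup n) {M : Subset n}
                          (M-subgroup : FiniteGroup.IsSubgroup G M) where
  open FiniteGroup G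
  open IsGroup isGroup using (assoc; identityˡ; identityʳ; inverseˡ; _\\_)
  open IsSubgroup M-subgroup
  open FiniteGroupProperties G

  infix 4 _∼_
  _∼_ : Rel (Fin n) 0ℓ
  x ∼ y = x \\ y ∈ M

  ∼-refl : ∀ {x} → x ∼ x
  ∼-refl {x} = subst (_∈ M) (sym (inverseˡ x)) ε-closed

  ∼-sym : ∀ {x y} → x ∼ y → y ∼ x
  ∼-sym {x} {y} x∼y =
    subst (_∈ M) (trans (⁻¹-anti-homo-∙ (x ⁻¹) y) (cong ((y ⁻¹) ∙_) (⁻¹-involutive x))) (⁻¹-closed x∼y)

  ∼-trans : ∀ {x y z} → x ∼ y → y ∼ z → x ∼ z
  ∼-trans {x} {y} {z} x∼y y∼z =
    subst (_∈ M) (trans (assoc (x ⁻¹) y (y \\ z)) (cong ((x ⁻¹) ∙_) (\\-leftDividesˡ y z))) (∙-closed x∼y y∼z)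

  ∼-translate⁺ : ∀ z {x y} → x ∼ y → z ∙ x ∼ z ∙ y
  ∼-translate⁺ z {x} {y} = subst (_∈ M) (sym (\\-translate z x y))

  ∼-translate⁻ : ∀ z {x y} → z ∙ x ∼ z ∙ y → x ∼ y
  ∼-translate⁻ z {x} {y} = subst (_∈ M) (\\-translate z x y)

  ∼-∙ʳ : ∀ {m x y} → m ∈ M → x ∼ y → x ∼ y ∙ m
  ∼-∙ʳ {m} {x} {y} m∈M x∼y = subst (_∈ M) (assoc (x ⁻¹) y m) (∙-closed x∼y m∈M)

  ε∼⇒∈ : ∀ {x} → ε ∼ x → x ∈ M
  ε∼⇒∈ {x} = subst (_∈ M) (trans (cong (_∙ x) ε⁻¹≈ε) (identityˡ x))

  ∈-cancelˡ : ∀ {u v} → u ∈ M → u ∙ v ∈ M → v ∈ M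
  ∈-cancelˡ {u} {v} u∈M uv∈M = subst (_∈ M) (\\-leftDividesʳ u v) (∙-closed (⁻¹-closed u∈M) uv∈M)

  pow-closed : ∀ {x} → x ∈ M → ∀ i → pow x i ∈ M
  pow-closed x∈M zero    = ε-closed
  pow-closed x∈M (suc i) = ∙-closed x∈M (pow-closed x∈M i)

  DistinctCosets : ∀ {r} → (Fin r → Fin n) → Set
  DistinctCosets c = ∀ {i j} → c i ∼ c j → i ≡ j

  ∷-distinctCosets : ∀ {r y} {c : Fin r → Fin n} → (∀ i → ¬ y ∼ c i) → DistinctCosets c →
                     DistinctCosets (y Vector.∷ c)
  ∷-distinctCosets y≁c c-distinct {zero}  {zero}  _     = refl
  ∷-distinctCosets y≁c c-distinct {zero}  {suc j} y∼cⱼ  = contradiction y∼cⱼ (y≁c j)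
  ∷-distinctCosets y≁c c-distinct {suc i} {zero}  cᵢ∼y  = contradiction (∼-sym cᵢ∼y) (y≁c i)
  ∷-distinctCosets y≁c c-distinct {suc i} {suc j} cᵢ∼cⱼ = cong suc (c-distinct cᵢ∼cⱼ)

  distinctCosets-bound : ∀ {r} {c : Fin r → Fin n} → DistinctCosets c → r * ∣ M ∣ ≤ n
  distinctCosets-bound {r} {c} c-distinct = begin
    r * ∣ M ∣                                    ≡⟨ cong (r *_) (∣p∣≡∑𝟙∈ M) ⟩
    r * sum (λ y → 𝟙 (y ∈? M))                   ≡⟨ ∑∑𝟙-translates (λ i → c i ⁻¹) (_∈? M) ⟨
    sum (λ y → sum (λ i → 𝟙 (c i \\ y ∈? M)))    ≤⟨ ∑-mono-≤ (λ y → ∑𝟙-unique≤1 (λ i → c i \\ y ∈? M)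
                                                       (λ cᵢ∼y cⱼ∼y → c-distinct (∼-trans cᵢ∼y (∼-sym cⱼ∼y)))) ⟩
    sum {n} (λ _ → 1)                            ≡⟨ ∑-1 n ⟩
    n                                            ∎
    where open ≤-Reasoning

module IndexPrime {n : ℕ} (G : FiniteGroup n) {p : ℕ} (p-prime : Prime p)
                  {k : ℕ} (n≡p^k : n ≡ p ^ k)
                  {M : Subset n} (M-subgroup : FiniteGroup.IsSubgroup G M)
                  (M-index : FiniteGroup.HasIndex G M p) where
  open FiniteGroup G
  open IsGroup isGroup using (assoc; identityˡ; identityʳ; _\\_)
  open IsSubgroup M-subgroup
  open FiniteGroupProperties G
  open SubgroupProperties G M-subgroup

  distinctCosets≤p : ∀ {r} {c : Fin r → Fin n} → DistinctCosets c → r ≤ p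
  distinctCosets≤p {r} c-distinct = *-cancelʳ-≤ r p ∣ M ∣ {{∣M∣≢0}} (begin
    r * ∣ M ∣  ≤⟨ distinctCosets-bound c-distinct ⟩
    n          ≡⟨ M-index ⟨
    ∣ M ∣ * p  ≡⟨ *-comm ∣ M ∣ p ⟩
    p * ∣ M ∣  ∎)
    where
    open ≤-Reasoning
    ∣M∣≢0 : NonZero ∣ M ∣
    ∣M∣≢0 = ≢-nonZero λ ∣M∣≡0 → <-irrefl (trans (cong (_* p) (sym ∣M∣≡0)) M-index) 0<n

  module FirstReturn (g c : Fin n) where

    Returns : Pred ℕ 0ℓ
    Returns i = c ∼ pow g i ∙ c

    returns? : Decidable Returns
    returns? i = c \\ (pow g i ∙ c) ∈? M

    returns-0 : Returns 0
    returns-0 = subst (c ∼_) (sym (identityˡ c)) ∼-refl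

    returns-+ : ∀ {a b} → Returns a → Returns b → Returns (a + b)
    returns-+ {a} {b} ra rb =
      ∼-trans ra (subst (pow g a ∙ c ∼_) (sym (pow-+-∙ g a b c)) (∼-translate⁺ (pow g a) rb))

    returns-∸ : ∀ {a b} → Returns a → Returns (a + b) → Returns b
    returns-∸ {a} {b} ra rab =
      ∼-translate⁻ (pow g a) (∼-trans (∼-sym ra) (subst (c ∼_) (pow-+-∙ g a b c) rab))

    returns-card : Returns n
    returns-card = subst (c ∼_) (sym (trans (cong (_∙ c) (pow-card≡ε g)) (identityˡ c))) ∼-refl

    firstReturn : ∃ (LeastPositive Returns)
    firstReturn = leastPositive returns? 0<n returns-card

    orbit : ∀ {r} → Fin r → Fin n
    orbit i = pow g (toℕ i) ∙ c

    module _ {r} (first : LeastPositive Returns r) where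
      open LeastPositive first

      orbit-distinctCosets : DistinctCosets (orbit {r})
      orbit-distinctCosets = leastPositive-separates first ∼-sym λ {i} {j} i≤j gⁱc∼gʲc →
        ∼-translate⁻ (pow g (toℕ i)) (subst (orbit i ∼_) (split i≤j) gⁱc∼gʲc)
        where
        split : ∀ {i j} → i ≤ j → pow g j ∙ c ≡ pow g i ∙ (pow g (j ∸ i) ∙ c)
        split {i} {j} i≤j =
          trans (cong (λ e → pow g e ∙ c) (sym (m+[n∸m]≡n i≤j))) (pow-+-∙ g i (j ∸ i) c)

      firstReturn∣card : r ∣ n
      firstReturn∣card = leastPositive-∣ returns-0 (λ {a b} → returns-+ {a} {b}) (λ {a b} → returns-∸ {a} {b})
                                         first returns-card

      firstReturn≡1⊎p : r ≡ 1 ⊎ r ≡ p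
      firstReturn≡1⊎p with m≤n⇒m<n∨m≡n (distinctCosets≤p orbit-distinctCosets)
      ... | inj₁ r<p = inj₁ (∣p^k∧<p⇒≡1 p-prime k (subst (r ∣_) n≡p^k firstReturn∣card) positive r<p)
      ... | inj₂ r≡p = inj₂ r≡p

  open FirstReturn

  firstReturn-∉ : ∀ {x} → x ∉ M → LeastPositive (Returns x ε) p
  firstReturn-∉ {x} x∉M with firstReturn x ε
  ... | r , first with firstReturn≡1⊎p x ε first
  ...   | inj₂ refl = first
  ...   | inj₁ refl = contradiction x∈M x∉M
    where
    x∈M : x ∈ M
    x∈M = subst (_∈ M) (trans (identityʳ (x ∙ ε)) (identityʳ x)) (ε∼⇒∈ (LeastPositive.holds first))

  pow-p∈M : ∀ x → pow x p ∈ M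
  pow-p∈M x with x ∈? M
  ... | yes x∈M = pow-closed x∈M p
  ... | no  x∉M = subst (_∈ M) (identityʳ (pow x p)) (ε∼⇒∈ (LeastPositive.holds (firstReturn-∉ x∉M)))

  normal : ∀ {m} c → m ∈ M → c ∼ m ∙ c
  normal {m} c m∈M with c ∈? M
  ... | yes c∈M = ∙-closed (⁻¹-closed c∈M) (∙-closed m∈M c∈M)
  ... | no  c∉M with firstReturn m c
  ...   | r , first with firstReturn≡1⊎p m c first
  ...     | inj₁ refl = subst (λ z → c ∼ z ∙ c) (identityʳ m) (LeastPositive.holds first)
  ...     | inj₂ refl =
    contradiction (distinctCosets≤p (∷-distinctCosets ε≁orbit (orbit-distinctCosets m c first))) (<-irrefl refl)
    where
    ε≁orbit : ∀ j → ¬ ε ∼ orbit m c j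
    ε≁orbit j ε∼mʲc = c∉M (∈-cancelˡ (pow-closed m∈M (toℕ j)) (ε∼⇒∈ ε∼mʲc))

  ∈⇒∙-comm∼ : ∀ {m} x → m ∈ M → m ∙ x ∼ x ∙ m
  ∈⇒∙-comm∼ {m} x m∈M = subst (m ∙ x ∼_) (\\-leftDividesˡ m (x ∙ m)) (∼-translate⁺ m x∼m⁻¹xm)
    where
    x∼m⁻¹xm : x ∼ (m ⁻¹) ∙ (x ∙ m)
    x∼m⁻¹xm = subst (x ∼_) (assoc (m ⁻¹) x m) (∼-∙ʳ m∈M (normal x (⁻¹-closed m∈M)))

  powers-cover : ∀ {x} → x ∉ M → ∀ y → ∃ λ (i : Fin p) → orbit x ε i ∼ y
  powers-cover {x} x∉M y with any? (λ i → orbit x ε i \\ y ∈? M)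
  ... | yes found = found
  ... | no  none  = contradiction
    (distinctCosets≤p (∷-distinctCosets y≁orbit (orbit-distinctCosets x ε (firstReturn-∉ x∉M)))) (<-irrefl refl)
    where
    y≁orbit : ∀ i → ¬ y ∼ orbit x ε i
    y≁orbit i y∼xⁱ = none (i , ∼-sym y∼xⁱ)

  commuting-coset∼ : ∀ {x a m} → x ∙ a ≡ a ∙ x → m ∈ M → (a ∙ m) ∙ x ∼ x ∙ (a ∙ m)
  commuting-coset∼ {x} {a} {m} xa≡ax m∈M =
    subst₂ _∼_ (sym (assoc a m x)) a[xm]≡x[am] (∼-translate⁺ a (∈⇒∙-comm∼ x m∈M))
    where
    open ≡-Reasoning
    a[xm]≡x[am] : a ∙ (x ∙ m) ≡ x ∙ (a ∙ m)
    a[xm]≡x[am] = begin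
      a ∙ (x ∙ m)  ≡⟨ assoc a x m ⟨
      (a ∙ x) ∙ m  ≡⟨ cong (_∙ m) xa≡ax ⟨
      (x ∙ a) ∙ m  ≡⟨ assoc x a m ⟩
      x ∙ (a ∙ m)  ∎

  ∙-comm∼ : ∀ x y → y ∙ x ∼ x ∙ y
  ∙-comm∼ x y with x ∈? M
  ... | yes x∈M = ∼-sym (∈⇒∙-comm∼ y x∈M)
  ... | no  x∉M with powers-cover x∉M y
  ...   | i , xⁱ∼y =
    subst (λ z → z ∙ x ∼ x ∙ z) (\\-leftDividesˡ (orbit x ε i) y) (commuting-coset∼ xxⁱ≡xⁱx xⁱ∼y)
    where
    xxⁱ≡xⁱx : x ∙ orbit x ε i ≡ orbit x ε i ∙ x
    xxⁱ≡xⁱx = subst (λ z → x ∙ z ≡ z ∙ x) (sym (identityʳ (pow x (toℕ i)))) (pow-comm x (toℕ i))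

lemma2p1 : (p : ℕ) → Prime p → (n : ℕ) → (G : FiniteGroup n) →
    IsPGroupOrder p n → 1 < n → FiniteGroup.IntersectionProperty G p →
    FiniteGroup.IsCommutative G × FiniteGroup.ExponentDivides G p
lemma2p1 p p-prime n G (k , n≡p^k) _ intersection = commutative , exponent
  where
  open FiniteGroup G
  open FiniteGroupProperties G using (⁅ε⁆-isSubgroup; \\≡ε⇒≡)
  module Index {M} (M-subgroup : IsSubgroup M) (M-index : HasIndex M p) =
    IndexPrime G p-prime {k} n≡p^k M-subgroup M-index

  ∈index-p⇒≡ε : ∀ {x} → (∀ {M} → IsSubgroup M → HasIndex M p → x ∈ M) → x ≡ ε
  ∈index-p⇒≡ε {x} x∈M = x∈⁅y⁆⇒x≡y ε (Equivalence.from (intersection ⁅ ε ⁆ ⁅ε⁆-isSubgroup x)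
                                                      (λ M M-subgroup M-index _ → x∈M M-subgroup M-index))

  commutative : IsCommutative
  commutative x y =
    sym (\\≡ε⇒≡ (∈index-p⇒≡ε λ M-subgroup M-index → Index.∙-comm∼ M-subgroup M-index x y))

  exponent : ExponentDivides p
  exponent x = ∈index-p⇒≡ε λ M-subgroup M-index → Index.pow-p∈M M-subgroup M-index x
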